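{- Let $\rho$ be a nonzero element of a field, and for an integer $n$ put $H_n=\begin{pmatrix}-1&-\rho^{n+1}\\\rho^{ -n}&\rho\end{pmatrix}$. For integers $a$, $l\ge1$, $n_1,\dots,n_l$ let $H_{a,n_1,\dots,n_l}=H_aH_{a+n_1+1}H_{a+n_1+n_2+2}\cdots H_{a+n_1+\cdots+n_l+l}$. Then $$H_{a,n_1,\dots,n_l}=H_a\begin{pmatrix}(-1)^l(1-\rho^{ -n_1})(1-\rho^{ -n_2})\cdots(1-\rho^{ -n_l})&0\\0&\rho^l(1-\rho^{n_1})(1-\rho^{n_2})\cdots(1-\rho^{n_l})\end{pmatrix}.$$ -}

module Defs where

open import Level using (Level; _⊔_; suc)
open import Algebra.Bundles using (CommutativeRing)
open import Relation.Nullary using (¬_)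
open import Data.Nat using (ℕ; zero) renaming (suc to sucℕ)
open import Data.Integer using (ℤ; +_; -[1+_]) renaming (-_ to ℤ-_; _+_ to _ℤ+_)
open import Data.List using (List; []; _∷_)

record Field (c ℓ : Level) : Set (Level.suc (c ⊔ ℓ)) where
  field
    commutativeRing : CommutativeRing c ℓ
  open CommutativeRing commutativeRing public
  field
    1≉0     : ¬ (1# ≈ 0#)
    inv     : (x : Carrier) → ¬ (x ≈ 0#) → Carrier
    inv-inv : (x : Carrier) (x≉0 : ¬ (x ≈ 0#)) → x * inv x x≉0 ≈ 1#

module FieldOps {c ℓ : Level} (F : Field c ℓ) where
  open Field F public

  pow : Carrier → ℕ → Carrier
  pow x zero     = 1#
  pow x (sucℕ n) = x * pow x n

  zpow : (x : Carrier) → ¬ (x ≈ 0#) → ℤ → Carrier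
  zpow x x≉0 (+ n)      = pow x n
  zpow x x≉0 -[1+ n ]   = pow (inv x x≉0) (sucℕ n)

  record M2 : Set c where
    constructor mat
    field
      a11 a12 a21 a22 : Carrier

  _⊗_ : M2 → M2 → M2
  mat a b c' d ⊗ mat e f g h =
    mat (a * e + b * g) (a * f + b * h) (c' * e + d * g) (c' * f + d * h)

  _≋_ : M2 → M2 → Set ℓ
  mat a b c' d ≋ mat e f g h = (a ≈ e) Data.Product.× (b ≈ f) Data.Product.× (c' ≈ g) Data.Product.× (d ≈ h)
    where import Data.Product

  infixl 7 _⟨*⟩_
  _⟨*⟩_ : Carrier → Carrier → Carrier
  _⟨*⟩_ = _*_

  module _ (ρ : Carrier) (ρ≉0 : ¬ (ρ ≈ 0#)) where
    ρ^ : ℤ → Carrier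
    ρ^ = zpow ρ ρ≉0

    H : ℤ → M2
    H n = mat (- 1#) (- ρ^ (n ℤ+ + 1)) (ρ^ (ℤ- n)) ρ

    -- Hprod a (n₁ ∷ … ∷ n_l) = H_a H_{a+n₁+1} H_{a+n₁+n₂+2} ⋯ H_{a+n₁+⋯+n_l+l}
    Hprod : ℤ → List ℤ → M2
    Hprod a []       = H a
    Hprod a (n ∷ ns) = H a ⊗ Hprod (a ℤ+ n ℤ+ + 1) ns

    prodMinus : List ℤ → Carrier
    prodMinus []       = 1#
    prodMinus (n ∷ ns) = (1# - ρ^ (ℤ- n)) * prodMinus ns

    prodPlus : List ℤ → Carrier
    prodPlus []       = 1#
    prodPlus (n ∷ ns) = (1# - ρ^ n) * prodPlus ns

{-# OPTIONS --safe #-}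
-- H_a = (-1, ρ^{-a})ᵀ (1, ρ^{a+1}) has rank one, so H_a M depends only on the row
-- (1, ρ^{a+1}) M.  For M = H_{a+n+1} this row is (ρ^{-n} - 1)(1, ρ^{a+n+2}), which equals
-- (1, ρ^{a+1}) diag(-(1 - ρ^{-n}), ρ(1 - ρ^n)).  Hence H_a H_{a+n+1} = H_a diag(…), and
-- induction on the list of exponents multiplies these diagonal factors together.
module Submission where

open import Defs
open import Level using (Level)
open import Relation.Nullary using (¬_)
open import Data.Nat as ℕ using (_≤_; zero; suc)
open import Data.Integer as ℤ using (ℤ; +_; -[1+_]; _⊖_)
open import Data.Integer.Properties as ℤP using ([1+m]⊖[1+n]≡m⊖n; m-n≡m⊖n)
open import Data.Integer.Tactic.RingSolver using (solve-∀)
open import Data.List using (List; length; []; _∷_; [_])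
open import Data.Product using (_,_; ∃₂)
open import Relation.Binary.Bundles using (Setoid)
open import Relation.Binary.PropositionalEquality as ≡ using (_≡_)
import Relation.Binary.Reasoning.Setoid as SetoidReasoning

m≡p⊖q : ∀ m → ∃₂ λ p q → m ≡ p ⊖ q
m≡p⊖q (+ p)    = p , 0 , ≡.refl
m≡p⊖q -[1+ q ] = 0 , suc q , ≡.refl

⊖-+-⊖ : ∀ p q p′ q′ → (p ⊖ q) ℤ.+ (p′ ⊖ q′) ≡ (p ℕ.+ p′) ⊖ (q ℕ.+ q′)
⊖-+-⊖ p q p′ q′ = begin
  (p ⊖ q) ℤ.+ (p′ ⊖ q′)              ≡⟨ ≡.cong₂ ℤ._+_ (m-n≡m⊖n p q) (m-n≡m⊖n p′ q′) ⟨
  (+ p ℤ.- + q) ℤ.+ (+ p′ ℤ.- + q′)  ≡⟨ regroup (+ p) (+ q) (+ p′) (+ q′) ⟩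
  (+ p ℤ.+ + p′) ℤ.- (+ q ℤ.+ + q′)  ≡⟨ m-n≡m⊖n (p ℕ.+ p′) (q ℕ.+ q′) ⟩
  (p ℕ.+ p′) ⊖ (q ℕ.+ q′)            ∎
  where
  open ≡.≡-Reasoning
  regroup : ∀ a b c d → (a ℤ.- b) ℤ.+ (c ℤ.- d) ≡ (a ℤ.+ c) ℤ.- (b ℤ.+ d)
  regroup = solve-∀

module _ {c ℓ : Level} (F : Field c ℓ) where
  open FieldOps F hiding (ρ^)
  open import Algebra.Solver.Ring.NaturalCoefficients.Default commutativeSemiring
  open import Algebra.Properties.Ring ring using (-1*x≈-x; -‿involutive)
  open import Algebra.Properties.CommutativeSemigroup *-commutativeSemigroup using (interchange)
  module ≈-Reasoning = SetoidReasoning setoid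

  -1*-1≈1 : - 1# * - 1# ≈ 1#
  -1*-1≈1 = trans (-1*x≈-x (- 1#)) (-‿involutive 1#)

  pow-homo-* : ∀ x m n → pow x (m ℕ.+ n) ≈ pow x m * pow x n
  pow-homo-* x zero    n = sym (*-identityˡ _)
  pow-homo-* x (suc m) n = trans (*-congˡ (pow-homo-* x m n)) (sym (*-assoc _ _ _))

  module _ (x : Carrier) (x≉0 : ¬ (x ≈ 0#)) where
    private
      x⁻¹ = inv x x≉0

    zpow-⊖ : ∀ p q → zpow x x≉0 (p ⊖ q) ≈ pow x p * pow x⁻¹ q
    zpow-⊖ zero    zero    = sym (*-identityˡ _)
    zpow-⊖ zero    (suc q) = sym (*-identityˡ _)
    zpow-⊖ (suc p) zero    = sym (*-identityʳ _)
    zpow-⊖ (suc p) (suc q) rewrite [1+m]⊖[1+n]≡m⊖n p q = begin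
      zpow x x≉0 (p ⊖ q)                       ≈⟨ zpow-⊖ p q ⟩
      pow x p * pow x⁻¹ q                      ≈⟨ *-identityˡ _ ⟨
      1# * (pow x p * pow x⁻¹ q)               ≈⟨ *-congʳ (inv-inv x x≉0) ⟨
      (x * x⁻¹) * (pow x p * pow x⁻¹ q)        ≈⟨ interchange x x⁻¹ (pow x p) (pow x⁻¹ q) ⟩
      (x * pow x p) * (x⁻¹ * pow x⁻¹ q)        ∎
      where open ≈-Reasoning

    zpow-homo-* : ∀ m n → zpow x x≉0 (m ℤ.+ n) ≈ zpow x x≉0 m * zpow x x≉0 n
    zpow-homo-* m n with m≡p⊖q m | m≡p⊖q n
    ... | p , q , ≡.refl | p′ , q′ , ≡.refl = begin
      zpow x x≉0 ((p ⊖ q) ℤ.+ (p′ ⊖ q′))                ≡⟨ ≡.cong (zpow x x≉0) (⊖-+-⊖ p q p′ q′) ⟩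
      zpow x x≉0 ((p ℕ.+ p′) ⊖ (q ℕ.+ q′))              ≈⟨ zpow-⊖ (p ℕ.+ p′) (q ℕ.+ q′) ⟩
      pow x (p ℕ.+ p′) * pow x⁻¹ (q ℕ.+ q′)             ≈⟨ *-cong (pow-homo-* x p p′) (pow-homo-* x⁻¹ q q′) ⟩
      (pow x p * pow x p′) * (pow x⁻¹ q * pow x⁻¹ q′)   ≈⟨ interchange _ _ _ _ ⟩
      (pow x p * pow x⁻¹ q) * (pow x p′ * pow x⁻¹ q′)   ≈⟨ *-cong (zpow-⊖ p q) (zpow-⊖ p′ q′) ⟨
      zpow x x≉0 (p ⊖ q) * zpow x x≉0 (p′ ⊖ q′)         ∎
      where open ≈-Reasoning

    zpow-*-zpow : ∀ m n {k} → m ℤ.+ n ≡ k → zpow x x≉0 m * zpow x x≉0 n ≈ zpow x x≉0 k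
    zpow-*-zpow m n ≡.refl = sym (zpow-homo-* m n)

  ≋-refl : ∀ {A} → A ≋ A
  ≋-refl {mat _ _ _ _} = refl , refl , refl , refl

  ≋-sym : ∀ {A B} → A ≋ B → B ≋ A
  ≋-sym {mat _ _ _ _} {mat _ _ _ _} (p , q , r , s) = sym p , sym q , sym r , sym s

  ≋-trans : ∀ {A B C} → A ≋ B → B ≋ C → A ≋ C
  ≋-trans {mat _ _ _ _} {mat _ _ _ _} {mat _ _ _ _} (p , q , r , s) (p′ , q′ , r′ , s′) =
    trans p p′ , trans q q′ , trans r r′ , trans s s′

  ≋-setoid : Setoid c ℓ
  ≋-setoid = record
    { Carrier       = M2
    ; _≈_           = _≋_
    ; isEquivalence = record { refl = ≋-refl ; sym = ≋-sym ; trans = ≋-trans }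
    }

  module ≋-Reasoning = SetoidReasoning ≋-setoid

  ⊗-cong : ∀ {A A′ B B′} → A ≋ A′ → B ≋ B′ → (A ⊗ B) ≋ (A′ ⊗ B′)
  ⊗-cong {mat _ _ _ _} {mat _ _ _ _} {mat _ _ _ _} {mat _ _ _ _}
         (p , q , r , s) (p′ , q′ , r′ , s′) =
    +-cong (*-cong p p′) (*-cong q r′) , +-cong (*-cong p q′) (*-cong q s′) ,
    +-cong (*-cong r p′) (*-cong s r′) , +-cong (*-cong r q′) (*-cong s s′)

  ⊗-assoc : ∀ A B C → ((A ⊗ B) ⊗ C) ≋ (A ⊗ (B ⊗ C))
  ⊗-assoc (mat a b c′ d) (mat e f g h) (mat x y z w) =
    entry a b x z e f g h , entry a b y w e f g h , entry c′ d x z e f g h , entry c′ d y w e f g h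
    where
    entry : ∀ a b x y e f g h →
      (a * e + b * g) * x + (a * f + b * h) * y ≈ a * (e * x + f * y) + b * (g * x + h * y)
    entry = solve 8 (λ a b x y e f g h → (a :* e :+ b :* g) :* x :+ (a :* f :+ b :* h) :* y
                                       := a :* (e :* x :+ f :* y) :+ b :* (g :* x :+ h :* y)) refl

  diag : Carrier → Carrier → M2
  diag d e = mat d 0# 0# e

  diag-⊗-diag : ∀ d e d′ e′ → (diag d e ⊗ diag d′ e′) ≋ diag (d * d′) (e * e′)
  diag-⊗-diag d e d′ e′ = product d d′ , zero-entry d e′ , zero-entry′ d′ e , product′ e e′
    where
    product : ∀ x y → x * y + 0# * 0# ≈ x * y
    product = solve 2 (λ x y → x :* y :+ con 0 :* con 0 := x :* y) refl
    product′ : ∀ x y → 0# * 0# + x * y ≈ x * y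
    product′ = solve 2 (λ x y → con 0 :* con 0 :+ x :* y := x :* y) refl
    zero-entry : ∀ x y → x * 0# + 0# * y ≈ 0#
    zero-entry = solve 2 (λ x y → x :* con 0 :+ con 0 :* y := con 0) refl
    zero-entry′ : ∀ x y → 0# * x + y * 0# ≈ 0#
    zero-entry′ = solve 2 (λ x y → con 0 :* x :+ y :* con 0 := con 0) refl

  outer : Carrier → Carrier → Carrier → Carrier → M2
  outer x y z w = mat (x * z) (x * w) (y * z) (y * w)

  outer-congʳ : ∀ x y {z w z′ w′} → z ≈ z′ → w ≈ w′ → outer x y z w ≋ outer x y z′ w′
  outer-congʳ x y z≈z′ w≈w′ = *-congˡ z≈z′ , *-congˡ w≈w′ , *-congˡ z≈z′ , *-congˡ w≈w′

  outer-⊗-outer : ∀ x y z w x′ y′ z′ w′ →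
    (outer x y z w ⊗ outer x′ y′ z′ w′) ≋ outer x y ((z * x′ + w * y′) * z′) ((z * x′ + w * y′) * w′)
  outer-⊗-outer x y z w x′ y′ z′ w′ =
    entry x z′ z w x′ y′ , entry x w′ z w x′ y′ , entry y z′ z w x′ y′ , entry y w′ z w x′ y′
    where
    entry : ∀ p q z w x y → (p * z) * (x * q) + (p * w) * (y * q) ≈ p * ((z * x + w * y) * q)
    entry = solve 6 (λ p q z w x y → (p :* z) :* (x :* q) :+ (p :* w) :* (y :* q)
                                   := p :* ((z :* x :+ w :* y) :* q)) refl

  outer-⊗-diag : ∀ x y z w d e → (outer x y z w ⊗ diag d e) ≋ outer x y (z * d) (w * e)
  outer-⊗-diag x y z w d e = left x z w d , right x z w e , left y z w d , right y z w e
    where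
    left : ∀ p z w d → (p * z) * d + (p * w) * 0# ≈ p * (z * d)
    left = solve 4 (λ p z w d → (p :* z) :* d :+ (p :* w) :* con 0 := p :* (z :* d)) refl
    right : ∀ p z w e → (p * z) * 0# + (p * w) * e ≈ p * (w * e)
    right = solve 4 (λ p z w e → (p :* z) :* con 0 :+ (p :* w) :* e := p :* (w :* e)) refl

  module _ (ρ : Carrier) (ρ≉0 : ¬ (ρ ≈ 0#)) where
    infix 8 ρ^_
    ρ^_ : ℤ → Carrier
    ρ^_ = zpow ρ ρ≉0

    diagonal : List ℤ → M2
    diagonal ns = diag (pow (- 1#) (length ns) * prodMinus ρ ρ≉0 ns) (pow ρ (length ns) * prodPlus ρ ρ≉0 ns)

    ⊗-diagonal-[] : ∀ A → (A ⊗ diagonal []) ≋ A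
    ⊗-diagonal-[] (mat a b c′ d) = left a b , right a b , left c′ d , right c′ d
      where
      left : ∀ x y → x * (1# * 1#) + y * 0# ≈ x
      left = solve 2 (λ x y → x :* (con 1 :* con 1) :+ y :* con 0 := x) refl
      right : ∀ x y → x * 0# + y * (1# * 1#) ≈ y
      right = solve 2 (λ x y → x :* con 0 :+ y :* (con 1 :* con 1) := y) refl

    diagonal-∷ : ∀ n ns → (diagonal [ n ] ⊗ diagonal ns) ≋ diagonal (n ∷ ns)
    diagonal-∷ n ns = ≋-trans (diag-⊗-diag _ _ _ _) (regroup _ _ _ _ , refl , refl , regroup _ _ _ _)
      where
      regroup : ∀ s t p q → ((s * 1#) * (t * 1#)) * (p * q) ≈ (s * p) * (t * q)
      regroup = solve 4 (λ s t p q → ((s :* con 1) :* (t :* con 1)) :* (p :* q) := (s :* p) :* (t :* q)) refl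

    H≋outer : ∀ a → H ρ ρ≉0 a ≋ outer (- 1#) (ρ^ (ℤ.- a)) 1# (ρ^ (a ℤ.+ + 1))
    H≋outer a =
      sym (*-identityʳ _) , sym (-1*x≈-x _) , sym (*-identityʳ _) ,
      (begin
        ρ                            ≈⟨ *-identityʳ ρ ⟨
        ρ^ (+ 1)                     ≈⟨ zpow-*-zpow ρ ρ≉0 (ℤ.- a) (a ℤ.+ + 1) (exponent a) ⟨
        ρ^ (ℤ.- a) * ρ^ (a ℤ.+ + 1)  ∎)
      where
      open ≈-Reasoning
      exponent : ∀ a → ℤ.- a ℤ.+ (a ℤ.+ + 1) ≡ + 1
      exponent = solve-∀

    module Consecutive (a n : ℤ) where
      b = a ℤ.+ n ℤ.+ + 1
      α = ρ^ (a ℤ.+ + 1)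
      α′ = ρ^ (b ℤ.+ + 1)
      s = 1# * - 1# + α * ρ^ (ℤ.- b)
      d = pow (- 1#) 1 * prodMinus ρ ρ≉0 [ n ]
      e = pow ρ 1 * prodPlus ρ ρ≉0 [ n ]

      s≈-1+ρ^-n : s ≈ - 1# + ρ^ (ℤ.- n)
      s≈-1+ρ^-n = +-cong (*-identityˡ (- 1#)) (zpow-*-zpow ρ ρ≉0 (a ℤ.+ + 1) (ℤ.- b) (exponent a n))
        where
        exponent : ∀ a n → (a ℤ.+ + 1) ℤ.+ ℤ.- (a ℤ.+ n ℤ.+ + 1) ≡ ℤ.- n
        exponent = solve-∀

      α′≈α*ρ*ρ^n : α′ ≈ α * ρ * ρ^ n
      α′≈α*ρ*ρ^n = begin
        α′                               ≈⟨ zpow-*-zpow ρ ρ≉0 ((a ℤ.+ + 1) ℤ.+ + 1) n (exponent a n) ⟨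
        ρ^ ((a ℤ.+ + 1) ℤ.+ + 1) * ρ^ n  ≈⟨ *-congʳ (zpow-homo-* ρ ρ≉0 (a ℤ.+ + 1) (+ 1)) ⟩
        α * ρ^ (+ 1) * ρ^ n              ≈⟨ *-congʳ (*-congˡ (*-identityʳ ρ)) ⟩
        α * ρ * ρ^ n                     ∎
        where
        open ≈-Reasoning
        exponent : ∀ a n → (a ℤ.+ + 1) ℤ.+ + 1 ℤ.+ n ≡ a ℤ.+ n ℤ.+ + 1 ℤ.+ + 1
        exponent = solve-∀

      first-entry : s * 1# ≈ 1# * d
      first-entry = begin
        s * 1#                                  ≈⟨ *-identityʳ s ⟩
        s                                       ≈⟨ s≈-1+ρ^-n ⟩
        - 1# + ρ^ (ℤ.- n)                       ≈⟨ +-congˡ (trans (*-congʳ -1*-1≈1) (*-identityˡ _)) ⟨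
        - 1# + (- 1# * - 1#) * ρ^ (ℤ.- n)       ≈⟨ expand (- 1#) (ρ^ (ℤ.- n)) ⟨
        1# * ((- 1# * 1#) * ((1# + - 1# * ρ^ (ℤ.- n)) * 1#))
                                                ≈⟨ *-congˡ (*-congˡ (*-congʳ (+-congˡ (-1*x≈-x _)))) ⟩
        1# * d                                  ∎
        where
        open ≈-Reasoning
        expand : ∀ m x → 1# * ((m * 1#) * ((1# + m * x) * 1#)) ≈ m + (m * m) * x
        expand = solve 2 (λ m x → con 1 :* ((m :* con 1) :* ((con 1 :+ m :* x) :* con 1))
                                := m :+ (m :* m) :* x) refl

      second-entry : s * α′ ≈ α * e
      second-entry = begin
        s * α′                                          ≈⟨ *-cong s≈-1+ρ^-n α′≈α*ρ*ρ^n ⟩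
        (- 1# + ρ^ (ℤ.- n)) * (α * ρ * ρ^ n)            ≈⟨ expand (- 1#) (ρ^ (ℤ.- n)) α ρ (ρ^ n) ⟩
        α * ρ * (ρ^ (ℤ.- n) * ρ^ n) + - 1# * (α * ρ * ρ^ n)
                                                        ≈⟨ +-congʳ (*-congˡ ρ^-n*ρ^n≈1) ⟩
        α * ρ * 1# + - 1# * (α * ρ * ρ^ n)              ≈⟨ factor (- 1#) α ρ (ρ^ n) ⟨
        α * ((ρ * 1#) * ((1# + - 1# * ρ^ n) * 1#))      ≈⟨ *-congˡ (*-congˡ (*-congʳ (+-congˡ (-1*x≈-x _)))) ⟩
        α * e                                           ∎
        where
        open ≈-Reasoning
        ρ^-n*ρ^n≈1 : ρ^ (ℤ.- n) * ρ^ n ≈ 1#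
        ρ^-n*ρ^n≈1 = zpow-*-zpow ρ ρ≉0 (ℤ.- n) n (ℤP.+-inverseˡ n)
        expand : ∀ m x a r y → (m + x) * (a * r * y) ≈ a * r * (x * y) + m * (a * r * y)
        expand = solve 5 (λ m x a r y → (m :+ x) :* (a :* r :* y) := a :* r :* (x :* y) :+ m :* (a :* r :* y)) refl
        factor : ∀ m a r y → a * ((r * 1#) * ((1# + m * y) * 1#)) ≈ a * r * 1# + m * (a * r * y)
        factor = solve 4 (λ m a r y → a :* ((r :* con 1) :* ((con 1 :+ m :* y) :* con 1))
                                    := a :* r :* con 1 :+ m :* (a :* r :* y)) refl

      H⊗H≋H⊗diagonal : (H ρ ρ≉0 a ⊗ H ρ ρ≉0 b) ≋ (H ρ ρ≉0 a ⊗ diagonal [ n ])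
      H⊗H≋H⊗diagonal = begin
        H ρ ρ≉0 a ⊗ H ρ ρ≉0 b                                           ≈⟨ ⊗-cong (H≋outer a) (H≋outer b) ⟩
        outer (- 1#) (ρ^ (ℤ.- a)) 1# α ⊗ outer (- 1#) (ρ^ (ℤ.- b)) 1# α′ ≈⟨ outer-⊗-outer _ _ _ _ _ _ _ _ ⟩
        outer (- 1#) (ρ^ (ℤ.- a)) (s * 1#) (s * α′)                      ≈⟨ outer-congʳ _ _ first-entry second-entry ⟩
        outer (- 1#) (ρ^ (ℤ.- a)) (1# * d) (α * e)                       ≈⟨ outer-⊗-diag _ _ _ _ _ _ ⟨
        outer (- 1#) (ρ^ (ℤ.- a)) 1# α ⊗ diag d e                        ≈⟨ ⊗-cong (H≋outer a) ≋-refl ⟨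
        H ρ ρ≉0 a ⊗ diagonal [ n ]                                       ∎
        where open ≋-Reasoning

    Hprod≋H⊗diagonal : ∀ a ns → Hprod ρ ρ≉0 a ns ≋ (H ρ ρ≉0 a ⊗ diagonal ns)
    Hprod≋H⊗diagonal a []       = ≋-sym (⊗-diagonal-[] (H ρ ρ≉0 a))
    Hprod≋H⊗diagonal a (n ∷ ns) = begin
      H ρ ρ≉0 a ⊗ Hprod ρ ρ≉0 b ns                        ≈⟨ ⊗-cong ≋-refl (Hprod≋H⊗diagonal b ns) ⟩
      H ρ ρ≉0 a ⊗ (H ρ ρ≉0 b ⊗ diagonal ns)               ≈⟨ ⊗-assoc _ _ _ ⟨
      (H ρ ρ≉0 a ⊗ H ρ ρ≉0 b) ⊗ diagonal ns               ≈⟨ ⊗-cong (Consecutive.H⊗H≋H⊗diagonal a n) ≋-refl ⟩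
      (H ρ ρ≉0 a ⊗ diagonal [ n ]) ⊗ diagonal ns          ≈⟨ ⊗-assoc _ _ _ ⟩
      H ρ ρ≉0 a ⊗ (diagonal [ n ] ⊗ diagonal ns)          ≈⟨ ⊗-cong ≋-refl (diagonal-∷ n ns) ⟩
      H ρ ρ≉0 a ⊗ diagonal (n ∷ ns)                       ∎
      where
      open ≋-Reasoning
      b = a ℤ.+ n ℤ.+ + 1

lemma4p17 : {c ℓ : Level} (F : Field c ℓ) → let open FieldOps F in
    (ρ : Field.Carrier F) (ρ≉0 : ¬ (Field._≈_ F ρ (Field.0# F))) (a : ℤ) (ns : List ℤ) → 1 ≤ length ns →
      Hprod ρ ρ≉0 a ns ≋
        (H ρ ρ≉0 a ⊗ mat (pow (Field.-_ F (Field.1# F)) (length ns) ⟨*⟩ prodMinus ρ ρ≉0 ns) (Field.0# F)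
                         (Field.0# F) (pow ρ (length ns) ⟨*⟩ prodPlus ρ ρ≉0 ns))
lemma4p17 F ρ ρ≉0 a ns _ = Hprod≋H⊗diagonal F ρ ρ≉0 a ns
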